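{- Let $\mathcal D$ be a finite non-empty set. For every closed formula $\varphi$ of $\mathrm{MSO}_{\mathcal D}$ there is a closed individual-free formula $\psi$ such that $\mathrm{MSO}_{\mathcal D}\vdash\varphi\leftrightarrow\psi$.
   Context: $\mathrm{MSO}_{\mathcal D}$: two-sorted classical theory with Individual variables $x,y,z$, Individual terms $t::=x\mid\mathsf{Root}\mid\mathsf S_d(t)$ ($d\in\mathcal D$), monadic Predicate variables $X,Y$, formulas $X(t)\mid t\doteq u\mid t<u\mid\varphi\lor\psi\mid\neg\varphi\mid\exists x\varphi\mid\exists X\varphi$. Provability: classical natural deduction for two-sorted first-order logic, with axioms: equality ($\forall x\,x\doteq x$, Leibniz scheme); tree axioms $\neg\exists x\bigvee_{d\ne d'}\mathsf S_d(x)\doteq\mathsf S_{d'}(x)$, injectivity of each $\mathsf S_d$, $\neg\exists x\,x<x$, transitivity of $<$, $\forall x\,\mathsf{Root}\le x$, $\forall x\forall y\bigwedge_d(x<\mathsf S_d(y)\leftrightarrow x\le y)$ ($t\le u:=t<u\lor t\doteq u$); comprehension $\exists X\forall y(X(y)\leftrightarrow\varphi)$ ($X$ not free in $\varphi$); induction $\forall X(X(\mathsf{Root})\to\bigwedge_d\forall y(X(y)\to X(\mathsf S_d(y)))\to\forall yX(y))$. Individual-free formulas are the MSO formulas built from the (defined) atomic formulas $X\subseteq Y:=\forall x(X(x)\to Y(x))$ and $\mathrm{FSucc}_d(X,Y):=\exists x\exists y(X(x)\land Y(y)\land\mathsf S_d(x)\doteq y)$ ($d\in\mathcal D$) by means of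 $\neg$, $\lor$ and monadic second-order quantification $\exists X$ only. -}

module Defs where

open import Data.Nat using (ℕ; zero; suc)
open import Data.Fin using (Fin; zero; suc; _≟_)
open import Data.List using (List; []; _∷_; map; concatMap; filter; allFin)
open import Data.List.Membership.Propositional using (_∈_)
open import Relation.Nullary.Decidable using (¬?)
open import Data.Product using (Σ; _×_; _,_)
open import Function using (_∘_)

-- The finite non-empty set of directions 𝒟 is Fin (suc k).
-- Individual variables and predicate variables are de Bruijn indices:
-- Term k i  : individual terms with i free individual variables,
-- Form k i p : formulas with i free individual and p free predicate variables.

data Term (k i : ℕ) : Set where
  var  : Fin i → Term k i
  Root : Term k i
  S    : Fin (suc k) → Term k i → Term k i

infix  7 _≐_ _≺_
infixr 4 _∨_
infix  6 ∼_

data Form (k i p : ℕ) : Set where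
  mem  : Fin p → Term k i → Form k i p
  _≐_  : Term k i → Term k i → Form k i p
  _≺_  : Term k i → Term k i → Form k i p
  _∨_  : Form k i p → Form k i p → Form k i p
  ∼_   : Form k i p → Form k i p
  ∃₁   : Form k (suc i) p → Form k i p
  ∃₂   : Form k i (suc p) → Form k i p

module _ {k i p : ℕ} where
  infixr 3 _∧_
  infixr 2 _⊃_
  infix  1 _⟷_

  _∧_ : Form k i p → Form k i p → Form k i p
  φ ∧ ψ = ∼ (∼ φ ∨ ∼ ψ)

  _⊃_ : Form k i p → Form k i p → Form k i p
  φ ⊃ ψ = ∼ φ ∨ ψ

  _⟷_ : Form k i p → Form k i p → Form k i p
  φ ⟷ ψ = (φ ⊃ ψ) ∧ (ψ ⊃ φ)

  falsum : Form k i p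
  falsum = ∼ (Root ≐ Root)

  _≼_ : Term k i → Term k i → Form k i p
  t ≼ u = (t ≺ u) ∨ (t ≐ u)

  bigOr : List (Form k i p) → Form k i p
  bigOr []           = falsum
  bigOr (φ ∷ [])     = φ
  bigOr (φ ∷ ψ ∷ ψs) = φ ∨ bigOr (ψ ∷ ψs)

∀₁ : ∀ {k i p} → Form k (suc i) p → Form k i p
∀₁ φ = ∼ ∃₁ (∼ φ)

∀₂ : ∀ {k i p} → Form k i (suc p) → Form k i p
∀₂ φ = ∼ ∃₂ (∼ φ)

bigAnd : ∀ {k i p} m → (Fin (suc m) → Form k i p) → Form k i p
bigAnd zero    f = f zero
bigAnd (suc m) f = f zero ∧ bigAnd m (f ∘ suc)

⋀ : ∀ {k i p} → (Fin (suc k) → Form k i p) → Form k i p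
⋀ {k} f = bigAnd k f

distinctPairs : ∀ k → List (Fin (suc k) × Fin (suc k))
distinctPairs k =
  concatMap (λ d → map (λ d' → d , d') (filter (λ d' → ¬? (d ≟ d')) (allFin (suc k))))
            (allFin (suc k))

substT : ∀ {k i j} → (Fin i → Term k j) → Term k i → Term k j
substT σ (var x) = σ x
substT σ Root    = Root
substT σ (S d t) = S d (substT σ t)

renT : ∀ {k i j} → (Fin i → Fin j) → Term k i → Term k j
renT ρ = substT (var ∘ ρ)

liftS : ∀ {k i j} → (Fin i → Term k j) → Fin (suc i) → Term k (suc j)
liftS σ zero    = var zero
liftS σ (suc x) = renT suc (σ x)

substF : ∀ {k i j p} → (Fin i → Term k j) → Form k i p → Form k j p
substF σ (mem X t) = mem X (substT σ t)
substF σ (t ≐ u)   = substT σ t ≐ substT σ u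
substF σ (t ≺ u)   = substT σ t ≺ substT σ u
substF σ (φ ∨ ψ)   = substF σ φ ∨ substF σ ψ
substF σ (∼ φ)     = ∼ substF σ φ
substF σ (∃₁ φ)    = ∃₁ (substF (liftS σ) φ)
substF σ (∃₂ φ)    = ∃₂ (substF σ φ)

liftR : ∀ {p q} → (Fin p → Fin q) → Fin (suc p) → Fin (suc q)
liftR ρ zero    = zero
liftR ρ (suc x) = suc (ρ x)

renP : ∀ {k i p q} → (Fin p → Fin q) → Form k i p → Form k i q
renP ρ (mem X t) = mem (ρ X) t
renP ρ (t ≐ u)   = t ≐ u
renP ρ (t ≺ u)   = t ≺ u
renP ρ (φ ∨ ψ)   = renP ρ φ ∨ renP ρ ψ
renP ρ (∼ φ)     = ∼ renP ρ φ
renP ρ (∃₁ φ)    = ∃₁ (renP ρ φ)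
renP ρ (∃₂ φ)    = ∃₂ (renP (liftR ρ) φ)

wkI : ∀ {k i p} → Form k i p → Form k (suc i) p
wkI = substF (var ∘ suc)

wkP : ∀ {k i p} → Form k i p → Form k i (suc p)
wkP = renP suc

sub0 : ∀ {k i p} → Form k (suc i) p → Term k i → Form k i p
sub0 {k} {i} φ t = substF σ φ
  where
  σ : Fin (suc i) → Term k i
  σ zero    = t
  σ (suc x) = var x

subP0 : ∀ {k i p} → Form k i (suc p) → Fin p → Form k i p
subP0 {p = p} φ Y = renP ρ φ
  where
  ρ : Fin (suc p) → Fin p
  ρ zero    = Y
  ρ (suc x) = x

-- Axioms of MSO_𝒟 (instances may contain free variables as parameters)

-- inside ∀x∀y : x = var 1, y = var 0 ; inside ∀x∀y∀z : x = var 2, y = var 1, z = var 0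
v0 : ∀ {k i} → Term k (suc i)
v0 = var zero
v1 : ∀ {k i} → Term k (suc (suc i))
v1 = var (suc zero)
v2 : ∀ {k i} → Term k (suc (suc (suc i)))
v2 = var (suc (suc zero))

-- for Leibniz: φ(x) and φ(y) inside ∀x∀y, where φ has its hole at var 0
atX : ∀ {i} → Fin (suc i) → Fin (suc (suc i))
atX zero    = suc zero
atX (suc j) = suc (suc j)

atY : ∀ {i} → Fin (suc i) → Fin (suc (suc i))
atY zero    = zero
atY (suc j) = suc (suc j)

data Axiom {k i p : ℕ} : Form k i p → Set where
  eq-refl   : Axiom (∀₁ (v0 ≐ v0))
  leibniz   : (φ : Form k (suc i) p) →
              Axiom (∀₁ (∀₁ ((v1 ≐ v0) ⊃ (substF (var ∘ atX) φ ⊃ substF (var ∘ atY) φ))))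
  tree-dist : Axiom (∼ ∃₁ (bigOr (map (λ { (d , d') → S d v0 ≐ S d' v0 }) (distinctPairs k))))
  tree-inj  : (d : Fin (suc k)) → Axiom (∀₁ (∀₁ ((S d v1 ≐ S d v0) ⊃ (v1 ≐ v0))))
  lt-irr    : Axiom (∼ ∃₁ (v0 ≺ v0))
  lt-trans  : Axiom (∀₁ (∀₁ (∀₁ ((v2 ≺ v1) ⊃ ((v1 ≺ v0) ⊃ (v2 ≺ v0))))))
  root-min  : Axiom (∀₁ (Root ≼ v0))
  lt-succ   : Axiom (∀₁ (∀₁ (⋀ (λ d → (v1 ≺ S d v0) ⟷ (v1 ≼ v0)))))
  compr     : (φ : Form k (suc i) p) →
              Axiom (∃₂ (∀₁ (mem zero v0 ⟷ wkP φ)))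
  induction : Axiom (∀₂ (mem zero Root ⊃
                (⋀ (λ d → ∀₁ (mem zero v0 ⊃ mem zero (S d v0))) ⊃ ∀₁ (mem zero v0))))

infix 0 _⊢_

data _⊢_ {k i p : ℕ} (Γ : List (Form k i p)) : Form k i p → Set where
  hyp   : ∀ {φ} → φ ∈ Γ → Γ ⊢ φ
  axm   : ∀ {φ} → Axiom φ → Γ ⊢ φ
  ∨I₁   : ∀ {φ ψ} → Γ ⊢ φ → Γ ⊢ φ ∨ ψ
  ∨I₂   : ∀ {φ ψ} → Γ ⊢ ψ → Γ ⊢ φ ∨ ψ
  ∨E    : ∀ {φ ψ χ} → Γ ⊢ φ ∨ ψ → φ ∷ Γ ⊢ χ → ψ ∷ Γ ⊢ χ → Γ ⊢ χ
  ∼I    : ∀ {φ ψ} → φ ∷ Γ ⊢ ψ → φ ∷ Γ ⊢ ∼ ψ → Γ ⊢ ∼ φ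
  ∼E    : ∀ {φ ψ} → Γ ⊢ φ → Γ ⊢ ∼ φ → Γ ⊢ ψ
  ∼∼E   : ∀ {φ} → Γ ⊢ ∼ ∼ φ → Γ ⊢ φ
  ∃₁I   : ∀ {φ} (t : Term k i) → Γ ⊢ sub0 φ t → Γ ⊢ ∃₁ φ
  ∃₁E   : ∀ {φ ψ} → Γ ⊢ ∃₁ φ → φ ∷ map wkI Γ ⊢ wkI ψ → Γ ⊢ ψ
  ∃₂I   : ∀ {φ} (Y : Fin p) → Γ ⊢ subP0 φ Y → Γ ⊢ ∃₂ φ
  ∃₂E   : ∀ {φ ψ} → Γ ⊢ ∃₂ φ → φ ∷ map wkP Γ ⊢ wkP ψ → Γ ⊢ ψ

MSO⊢ : ∀ k → Form k 0 0 → Set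
MSO⊢ k φ = [] ⊢ φ

data IFForm (k p : ℕ) : Set where
  _⊆̇_    : Fin p → Fin p → IFForm k p
  FSucc : Fin (suc k) → Fin p → Fin p → IFForm k p
  ¬ᵢ    : IFForm k p → IFForm k p
  _∨ᵢ_  : IFForm k p → IFForm k p → IFForm k p
  ∃ᵢ    : IFForm k (suc p) → IFForm k p

⟦_⟧ : ∀ {k p} → IFForm k p → Form k 0 p
⟦ X ⊆̇ Y ⟧       = ∀₁ (mem X v0 ⊃ mem Y v0)
⟦ FSucc d X Y ⟧ = ∃₁ (∃₁ (mem X v1 ∧ (mem Y v0 ∧ (S d v1 ≐ v0))))
⟦ ¬ᵢ ψ ⟧        = ∼ ⟦ ψ ⟧
⟦ ψ ∨ᵢ χ ⟧      = ⟦ ψ ⟧ ∨ ⟦ χ ⟧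
⟦ ∃ᵢ ψ ⟧        = ∃₂ ⟦ ψ ⟧

-- An individual x is coded by the singleton {x}. Individual-free formulas can say that a set
-- is a singleton (nonempty, with no nonempty proper subset), that it is {Root} (a singleton
-- with nothing below it), that it is {S_d x} given {x} (via FSucc), and that x < y: y lies in
-- every set W containing all successors of x and closed under successors. For the last one,
-- the induction axiom gives "x < y implies y ∈ W", and W = {v | x < v} gives the converse.
-- Translating atoms through these codings and ∃x to ∃X (X singleton ∧ …), every formula is
-- provably equivalent to its translation under the hypotheses X_j = {x_j}, by induction on
-- the formula; a closed formula needs no hypotheses.

module Submission where

open import Data.Fin using (Fin; zero; suc)
open import Data.List using (List; []; _∷_; map)
open import Data.List.Membership.Propositional using (_∈_)
open import Data.List.Membership.Propositional.Properties using (∈-map⁺)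
open import Data.List.Relation.Binary.Subset.Propositional using (_⊆_)
open import Data.List.Relation.Binary.Subset.Propositional.Properties using (map⁺; ∷⁺ʳ)
open import Data.List.Relation.Unary.Any using (here; there)
open import Data.Nat using (ℕ; zero; suc)
open import Data.Product using (Σ; _,_)
open import Function using (_∘_)
open import Relation.Binary.PropositionalEquality

open import Defs

private variable
  k i j l p q r : ℕ
  Γ Δ : List (Form k i p)
  A B C D : Form k i p

substT-ext : ∀ {σ τ : Fin i → Term k j} → (∀ x → σ x ≡ τ x) → ∀ t → substT σ t ≡ substT τ t
substT-ext e (var x) = e x
substT-ext e Root = refl
substT-ext e (S d t) = cong (S d) (substT-ext e t)

substT-comp : ∀ (σ : Fin j → Term k l) (τ : Fin i → Term k j) t →
  substT σ (substT τ t) ≡ substT (λ x → substT σ (τ x)) t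
substT-comp σ τ (var x) = refl
substT-comp σ τ Root = refl
substT-comp σ τ (S d t) = cong (S d) (substT-comp σ τ t)

substT-id : ∀ (t : Term k i) → substT var t ≡ t
substT-id (var x) = refl
substT-id Root = refl
substT-id (S d t) = cong (S d) (substT-id t)

wkT : Term k i → Term k (suc i)
wkT = renT suc

liftS-ext : ∀ {σ τ : Fin i → Term k j} → (∀ x → σ x ≡ τ x) → ∀ x → liftS σ x ≡ liftS τ x
liftS-ext e zero = refl
liftS-ext e (suc x) = cong (renT suc) (e x)

liftS-comp : ∀ (σ : Fin j → Term k l) (τ : Fin i → Term k j) x →
  substT (liftS σ) (liftS τ x) ≡ liftS (λ y → substT σ (τ y)) x
liftS-comp σ τ zero = refl
liftS-comp σ τ (suc x) =
  trans (substT-comp (liftS σ) (var ∘ suc) (τ x)) (sym (substT-comp (var ∘ suc) σ (τ x)))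

liftS-wkT : ∀ (σ : Fin i → Term k j) t → substT (liftS σ) (wkT t) ≡ wkT (substT σ t)
liftS-wkT σ t = trans (substT-comp (liftS σ) (var ∘ suc) t) (sym (substT-comp (var ∘ suc) σ t))

substF-ext : ∀ {σ τ : Fin i → Term k j} → (∀ x → σ x ≡ τ x) → (φ : Form k i p) → substF σ φ ≡ substF τ φ
substF-ext e (mem X t) = cong (mem X) (substT-ext e t)
substF-ext e (t ≐ u) = cong₂ _≐_ (substT-ext e t) (substT-ext e u)
substF-ext e (t ≺ u) = cong₂ _≺_ (substT-ext e t) (substT-ext e u)
substF-ext e (φ ∨ ψ) = cong₂ _∨_ (substF-ext e φ) (substF-ext e ψ)
substF-ext e (∼ φ) = cong ∼_ (substF-ext e φ)
substF-ext e (∃₁ φ) = cong ∃₁ (substF-ext (liftS-ext e) φ)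
substF-ext e (∃₂ φ) = cong ∃₂ (substF-ext e φ)

substF-comp : ∀ (σ : Fin j → Term k l) (τ : Fin i → Term k j) (φ : Form k i p) →
  substF σ (substF τ φ) ≡ substF (λ x → substT σ (τ x)) φ
substF-comp σ τ (mem X t) = cong (mem X) (substT-comp σ τ t)
substF-comp σ τ (t ≐ u) = cong₂ _≐_ (substT-comp σ τ t) (substT-comp σ τ u)
substF-comp σ τ (t ≺ u) = cong₂ _≺_ (substT-comp σ τ t) (substT-comp σ τ u)
substF-comp σ τ (φ ∨ ψ) = cong₂ _∨_ (substF-comp σ τ φ) (substF-comp σ τ ψ)
substF-comp σ τ (∼ φ) = cong ∼_ (substF-comp σ τ φ)
substF-comp σ τ (∃₁ φ) = cong ∃₁ (trans (substF-comp (liftS σ) (liftS τ) φ) (substF-ext (liftS-comp σ τ) φ))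
substF-comp σ τ (∃₂ φ) = cong ∃₂ (substF-comp σ τ φ)

liftS-id : ∀ (x : Fin (suc i)) → liftS {k} var x ≡ var x
liftS-id zero = refl
liftS-id (suc x) = refl

substF-id : ∀ (φ : Form k i p) → substF var φ ≡ φ
substF-id (mem X t) = cong (mem X) (substT-id t)
substF-id (t ≐ u) = cong₂ _≐_ (substT-id t) (substT-id u)
substF-id (t ≺ u) = cong₂ _≺_ (substT-id t) (substT-id u)
substF-id (φ ∨ ψ) = cong₂ _∨_ (substF-id φ) (substF-id ψ)
substF-id (∼ φ) = cong ∼_ (substF-id φ)
substF-id (∃₁ φ) = cong ∃₁ (trans (substF-ext liftS-id φ) (substF-id φ))
substF-id (∃₂ φ) = cong ∃₂ (substF-id φ)

renP-ext : ∀ {ρ ρ' : Fin p → Fin q} → (∀ x → ρ x ≡ ρ' x) → (φ : Form k i p) → renP ρ φ ≡ renP ρ' φ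
renP-ext e (mem X t) = cong (λ Y → mem Y t) (e X)
renP-ext e (t ≐ u) = refl
renP-ext e (t ≺ u) = refl
renP-ext e (φ ∨ ψ) = cong₂ _∨_ (renP-ext e φ) (renP-ext e ψ)
renP-ext e (∼ φ) = cong ∼_ (renP-ext e φ)
renP-ext e (∃₁ φ) = cong ∃₁ (renP-ext e φ)
renP-ext {ρ = ρ} {ρ'} e (∃₂ φ) = cong ∃₂ (renP-ext e' φ)
  where
  e' : ∀ x → liftR ρ x ≡ liftR ρ' x
  e' zero = refl
  e' (suc x) = cong suc (e x)

renP-comp : ∀ (ρ : Fin q → Fin r) (ρ' : Fin p → Fin q) (φ : Form k i p) →
  renP ρ (renP ρ' φ) ≡ renP (ρ ∘ ρ') φ
renP-comp ρ ρ' (mem X t) = refl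
renP-comp ρ ρ' (t ≐ u) = refl
renP-comp ρ ρ' (t ≺ u) = refl
renP-comp ρ ρ' (φ ∨ ψ) = cong₂ _∨_ (renP-comp ρ ρ' φ) (renP-comp ρ ρ' ψ)
renP-comp ρ ρ' (∼ φ) = cong ∼_ (renP-comp ρ ρ' φ)
renP-comp ρ ρ' (∃₁ φ) = cong ∃₁ (renP-comp ρ ρ' φ)
renP-comp ρ ρ' (∃₂ φ) = cong ∃₂ (trans (renP-comp (liftR ρ) (liftR ρ') φ) (renP-ext e φ))
  where
  e : ∀ x → liftR ρ (liftR ρ' x) ≡ liftR (ρ ∘ ρ') x
  e zero = refl
  e (suc x) = refl

renP-id : ∀ (φ : Form k i p) → renP (λ x → x) φ ≡ φ
renP-id (mem X t) = refl
renP-id (t ≐ u) = refl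
renP-id (t ≺ u) = refl
renP-id (φ ∨ ψ) = cong₂ _∨_ (renP-id φ) (renP-id ψ)
renP-id (∼ φ) = cong ∼_ (renP-id φ)
renP-id (∃₁ φ) = cong ∃₁ (renP-id φ)
renP-id (∃₂ φ) = cong ∃₂ (trans (renP-ext e φ) (renP-id φ))
  where
  e : ∀ x → liftR (λ x → x) x ≡ x
  e zero = refl
  e (suc x) = refl

substF-renP : ∀ (σ : Fin i → Term k j) (ρ : Fin p → Fin q) (φ : Form k i p) →
  substF σ (renP ρ φ) ≡ renP ρ (substF σ φ)
substF-renP σ ρ (mem X t) = refl
substF-renP σ ρ (t ≐ u) = refl
substF-renP σ ρ (t ≺ u) = refl
substF-renP σ ρ (φ ∨ ψ) = cong₂ _∨_ (substF-renP σ ρ φ) (substF-renP σ ρ ψ)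
substF-renP σ ρ (∼ φ) = cong ∼_ (substF-renP σ ρ φ)
substF-renP σ ρ (∃₁ φ) = cong ∃₁ (substF-renP (liftS σ) ρ φ)
substF-renP σ ρ (∃₂ φ) = cong ∃₂ (substF-renP σ (liftR ρ) φ)

σ0 : Term k i → Fin (suc i) → Term k i
σ0 t zero = t
σ0 t (suc x) = var x

sub0-as-substF : ∀ (φ : Form k (suc i) p) t → sub0 φ t ≡ substF (σ0 t) φ
sub0-as-substF φ t = substF-ext (λ { zero → refl ; (suc x) → refl }) φ

σ0-wkT : ∀ (t u : Term k i) → substT (σ0 u) (wkT t) ≡ t
σ0-wkT t u = trans (substT-comp (σ0 u) (var ∘ suc) t) (substT-id t)

σ₂ : Term k i → Term k i → Fin (suc (suc i)) → Term k i
σ₂ t u x = substT (σ0 u) (liftS (σ0 t) x)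

sub0-lift-wk : ∀ (φ : Form k (suc i) p) → sub0 (substF (liftS (var ∘ suc)) φ) (var zero) ≡ φ
sub0-lift-wk φ = trans (sub0-as-substF _ (var zero)) (trans (substF-comp (σ0 (var zero)) (liftS (var ∘ suc)) φ)
                  (trans (substF-ext (λ { zero → refl ; (suc x) → refl }) φ) (substF-id φ)))

ρ0 : Fin p → Fin (suc p) → Fin p
ρ0 Y zero = Y
ρ0 Y (suc x) = x

subP0-as-renP : ∀ (φ : Form k i (suc p)) Y → subP0 φ Y ≡ renP (ρ0 Y) φ
subP0-as-renP φ Y = renP-ext (λ { zero → refl ; (suc x) → refl }) φ

subP0-lift-wk : ∀ (φ : Form k i (suc p)) → subP0 (renP (liftR suc) φ) zero ≡ φ
subP0-lift-wk φ = trans (subP0-as-renP _ zero) (trans (renP-comp (ρ0 zero) (liftR suc) φ)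
                   (trans (renP-ext (λ { zero → refl ; (suc x) → refl }) φ) (renP-id φ)))

substF-bigAnd : ∀ (σ : Fin i → Term k j) m (f : Fin (suc m) → Form k i p) →
  substF σ (bigAnd m f) ≡ bigAnd m (substF σ ∘ f)
substF-bigAnd σ zero f = refl
substF-bigAnd σ (suc m) f = cong (λ a → ∼ (∼ substF σ (f zero) ∨ ∼ a)) (substF-bigAnd σ m (f ∘ suc))

renP-bigAnd : ∀ (ρ : Fin p → Fin q) m (f : Fin (suc m) → Form k i p) →
  renP ρ (bigAnd m f) ≡ bigAnd m (renP ρ ∘ f)
renP-bigAnd ρ zero f = refl
renP-bigAnd ρ (suc m) f = cong (λ a → ∼ (∼ renP ρ (f zero) ∨ ∼ a)) (renP-bigAnd ρ m (f ∘ suc))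

-- ⟦_⟧ lives at individual context 0; induction on formulas needs it under individual binders.
⟪_⟫ : IFForm k p → Form k i p
⟪ X ⊆̇ Y ⟫ = ∀₁ (mem X v0 ⊃ mem Y v0)
⟪ FSucc d X Y ⟫ = ∃₁ (∃₁ (mem X v1 ∧ (mem Y v0 ∧ (S d v1 ≐ v0))))
⟪ ¬ᵢ ψ ⟫ = ∼ ⟪ ψ ⟫
⟪ ψ ∨ᵢ χ ⟫ = ⟪ ψ ⟫ ∨ ⟪ χ ⟫
⟪ ∃ᵢ ψ ⟫ = ∃₂ ⟪ ψ ⟫

renIF : (Fin p → Fin q) → IFForm k p → IFForm k q
renIF ρ (X ⊆̇ Y) = ρ X ⊆̇ ρ Y
renIF ρ (FSucc d X Y) = FSucc d (ρ X) (ρ Y)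
renIF ρ (¬ᵢ ψ) = ¬ᵢ (renIF ρ ψ)
renIF ρ (ψ ∨ᵢ χ) = renIF ρ ψ ∨ᵢ renIF ρ χ
renIF ρ (∃ᵢ ψ) = ∃ᵢ (renIF (liftR ρ) ψ)

substF-⟪⟫ : ∀ (σ : Fin i → Term k j) (ψ : IFForm k p) → substF σ ⟪ ψ ⟫ ≡ ⟪ ψ ⟫
substF-⟪⟫ σ (X ⊆̇ Y) = refl
substF-⟪⟫ σ (FSucc d X Y) = refl
substF-⟪⟫ σ (¬ᵢ ψ) = cong ∼_ (substF-⟪⟫ σ ψ)
substF-⟪⟫ σ (ψ ∨ᵢ χ) = cong₂ _∨_ (substF-⟪⟫ σ ψ) (substF-⟪⟫ σ χ)
substF-⟪⟫ σ (∃ᵢ ψ) = cong ∃₂ (substF-⟪⟫ σ ψ)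

renP-⟪⟫ : ∀ (ρ : Fin p → Fin q) (ψ : IFForm k p) → renP ρ (⟪_⟫ {i = i} ψ) ≡ ⟪ renIF ρ ψ ⟫
renP-⟪⟫ ρ (X ⊆̇ Y) = refl
renP-⟪⟫ ρ (FSucc d X Y) = refl
renP-⟪⟫ ρ (¬ᵢ ψ) = cong ∼_ (renP-⟪⟫ ρ ψ)
renP-⟪⟫ ρ (ψ ∨ᵢ χ) = cong₂ _∨_ (renP-⟪⟫ ρ ψ) (renP-⟪⟫ ρ χ)
renP-⟪⟫ ρ (∃ᵢ ψ) = cong ∃₂ (renP-⟪⟫ (liftR ρ) ψ)

⟪⟫≡⟦⟧ : ∀ (ψ : IFForm k p) → ⟪ ψ ⟫ ≡ ⟦ ψ ⟧
⟪⟫≡⟦⟧ (X ⊆̇ Y) = refl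
⟪⟫≡⟦⟧ (FSucc d X Y) = refl
⟪⟫≡⟦⟧ (¬ᵢ ψ) = cong ∼_ (⟪⟫≡⟦⟧ ψ)
⟪⟫≡⟦⟧ (ψ ∨ᵢ χ) = cong₂ _∨_ (⟪⟫≡⟦⟧ ψ) (⟪⟫≡⟦⟧ χ)
⟪⟫≡⟦⟧ (∃ᵢ ψ) = cong ∃₂ (⟪⟫≡⟦⟧ ψ)

wkI-⟪⟫ : ∀ (ψ : IFForm k p) → wkI (⟪_⟫ {i = i} ψ) ≡ ⟪ ψ ⟫
wkI-⟪⟫ ψ = substF-⟪⟫ _ ψ

infixr 3 _∧ᵢ_
infixr 2 _⊃ᵢ_
_∧ᵢ_ : IFForm k q → IFForm k q → IFForm k q
ψ ∧ᵢ χ = ¬ᵢ (¬ᵢ ψ ∨ᵢ ¬ᵢ χ)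
_⊃ᵢ_ : IFForm k q → IFForm k q → IFForm k q
ψ ⊃ᵢ χ = ¬ᵢ ψ ∨ᵢ χ
∀ᵢ : IFForm k (suc q) → IFForm k q
∀ᵢ ψ = ¬ᵢ (∃ᵢ (¬ᵢ ψ))

bigAndᵢ : ∀ m → (Fin (suc m) → IFForm k q) → IFForm k q
bigAndᵢ zero f = f zero
bigAndᵢ (suc m) f = f zero ∧ᵢ bigAndᵢ m (f ∘ suc)

renIF-bigAndᵢ : ∀ (ρ : Fin p → Fin q) m (f : Fin (suc m) → IFForm k p) →
  renIF ρ (bigAndᵢ m f) ≡ bigAndᵢ m (renIF ρ ∘ f)
renIF-bigAndᵢ ρ zero f = refl
renIF-bigAndᵢ ρ (suc m) f = cong (λ a → ¬ᵢ (¬ᵢ (renIF ρ (f zero)) ∨ᵢ ¬ᵢ a)) (renIF-bigAndᵢ ρ m (f ∘ suc))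

bigAndᵢ-ext : ∀ m {f g : Fin (suc m) → IFForm k q} → (∀ d → f d ≡ g d) → bigAndᵢ m f ≡ bigAndᵢ m g
bigAndᵢ-ext zero e = e zero
bigAndᵢ-ext (suc m) e = cong₂ (λ a b → ¬ᵢ (¬ᵢ a ∨ᵢ ¬ᵢ b)) (e zero) (bigAndᵢ-ext m (e ∘ suc))

weaken : Γ ⊆ Δ → Γ ⊢ A → Δ ⊢ A
weaken s (hyp x)      = hyp (s x)
weaken s (axm x)      = axm x
weaken s (∨I₁ d)      = ∨I₁ (weaken s d)
weaken s (∨I₂ d)      = ∨I₂ (weaken s d)
weaken s (∨E d d₁ d₂) = ∨E (weaken s d) (weaken (∷⁺ʳ _ s) d₁) (weaken (∷⁺ʳ _ s) d₂)
weaken s (∼I d d₁)    = ∼I (weaken (∷⁺ʳ _ s) d) (weaken (∷⁺ʳ _ s) d₁)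
weaken s (∼E d d₁)    = ∼E (weaken s d) (weaken s d₁)
weaken s (∼∼E d)      = ∼∼E (weaken s d)
weaken s (∃₁I t d)    = ∃₁I t (weaken s d)
weaken s (∃₁E d d₁)   = ∃₁E (weaken s d) (weaken (∷⁺ʳ _ (map⁺ wkI s)) d₁)
weaken s (∃₂I Y d)    = ∃₂I Y (weaken s d)
weaken s (∃₂E d d₁)   = ∃₂E (weaken s d) (weaken (∷⁺ʳ _ (map⁺ wkP s)) d₁)

wk : Γ ⊢ A → B ∷ Γ ⊢ A
wk = weaken there

wk₁ : A ∷ Γ ⊢ C → A ∷ B ∷ Γ ⊢ C
wk₁ = weaken (∷⁺ʳ _ there)

h0 : A ∷ Γ ⊢ A
h0 = hyp (here refl)
h1 : B ∷ A ∷ Γ ⊢ A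
h1 = wk h0
h2 : ∀ {C} → C ∷ B ∷ A ∷ Γ ⊢ A
h2 = wk h1
h3 : ∀ {C D} → D ∷ C ∷ B ∷ A ∷ Γ ⊢ A
h3 = wk h2
h4 : ∀ {C D E} → E ∷ D ∷ C ∷ B ∷ A ∷ Γ ⊢ A
h4 = wk h3
h6 : ∀ {C D E F G} → G ∷ F ∷ E ∷ D ∷ C ∷ B ∷ A ∷ Γ ⊢ A
h6 = wk (wk h4)
h8 : ∀ {C D E F G H I} → I ∷ H ∷ G ∷ F ∷ E ∷ D ∷ C ∷ B ∷ A ∷ Γ ⊢ A
h8 = wk (wk h6)

conv : A ≡ B → Γ ⊢ A → Γ ⊢ B
conv refl d = d

cut : Γ ⊢ A → A ∷ Γ ⊢ B → Γ ⊢ B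
cut {A = A} {B = B} a b = ∼∼E (∼I {ψ = A} (wk a) (∼I {ψ = B} (wk₁ b) h1))

raa : ∼ A ∷ Γ ⊢ B → ∼ A ∷ Γ ⊢ ∼ B → Γ ⊢ A
raa d e = ∼∼E (∼I d e)

⊃I : A ∷ Γ ⊢ B → Γ ⊢ A ⊃ B
⊃I {A = A} {B = B} d = raa {B = ∼ A ∨ B} (∨I₁ (∼I {ψ = ∼ A ∨ B} (∨I₂ (wk₁ d)) h1)) h0

⊃E : Γ ⊢ A ⊃ B → Γ ⊢ A → Γ ⊢ B
⊃E d a = ∨E d (∼E (wk a) h0) h0

∧I : Γ ⊢ A → Γ ⊢ B → Γ ⊢ A ∧ B
∧I {A = A} a b = ∼I {ψ = A} (wk a) (∨E h0 h0 (∼E (wk (wk b)) h0))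

∧E₁ : Γ ⊢ A ∧ B → Γ ⊢ A
∧E₁ d = raa (∨I₁ h0) (wk d)

∧E₂ : Γ ⊢ A ∧ B → Γ ⊢ B
∧E₂ d = raa (∨I₂ h0) (wk d)

⟷I : A ∷ Γ ⊢ B → B ∷ Γ ⊢ A → Γ ⊢ A ⟷ B
⟷I d e = ∧I (⊃I d) (⊃I e)

⟷E₁ : Γ ⊢ A ⟷ B → Γ ⊢ A → Γ ⊢ B
⟷E₁ d a = ⊃E (∧E₁ d) a

⟷E₂ : Γ ⊢ A ⟷ B → Γ ⊢ B → Γ ⊢ A
⟷E₂ d b = ⊃E (∧E₂ d) b

excluded-middle : Γ ⊢ A ∨ ∼ A
excluded-middle {A = A} = raa {B = A ∨ ∼ A} (∨I₂ (∼I {ψ = A ∨ ∼ A} (∨I₁ h0) h1)) h0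

∀₁I : map wkI Γ ⊢ A → Γ ⊢ ∀₁ A
∀₁I d = ∼I {ψ = falsum} (∃₁E h0 (∼E (wk (wk d)) h0)) (∃₁E h0 (∼E (wk (wk d)) h0))

∀₁E : Γ ⊢ ∀₁ A → (t : Term k i) → Γ ⊢ sub0 A t
∀₁E d t = raa (∃₁I t h0) (wk d)

∀₂I : map wkP Γ ⊢ A → Γ ⊢ ∀₂ A
∀₂I d = ∼I {ψ = falsum} (∃₂E h0 (∼E (wk (wk d)) h0)) (∃₂E h0 (∼E (wk (wk d)) h0))

∀₂E : Γ ⊢ ∀₂ A → (Y : Fin p) → Γ ⊢ subP0 A Y
∀₂E d Y = raa (∃₂I Y h0) (wk d)

bigAndI : ∀ m {f : Fin (suc m) → Form k i p} → (∀ d → Γ ⊢ f d) → Γ ⊢ bigAnd m f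
bigAndI zero    g = g zero
bigAndI (suc m) g = ∧I (g zero) (bigAndI m (g ∘ suc))

bigAndE : ∀ m {f : Fin (suc m) → Form k i p} → Γ ⊢ bigAnd m f → ∀ d → Γ ⊢ f d
bigAndE zero    a zero    = a
bigAndE (suc m) a zero    = ∧E₁ a
bigAndE (suc m) a (suc d) = bigAndE m (∧E₂ a) d

bigAndᵢ-intro : ∀ m {f : Fin (suc m) → IFForm k p} → (∀ d → Γ ⊢ ⟪ f d ⟫) → Γ ⊢ ⟪ bigAndᵢ m f ⟫
bigAndᵢ-intro zero g = g zero
bigAndᵢ-intro (suc m) g = ∧I (g zero) (bigAndᵢ-intro m (g ∘ suc))

bigAndᵢ-elim : ∀ m {f : Fin (suc m) → IFForm k p} → Γ ⊢ ⟪ bigAndᵢ m f ⟫ → ∀ d → Γ ⊢ ⟪ f d ⟫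
bigAndᵢ-elim zero a zero = a
bigAndᵢ-elim (suc m) a zero = ∧E₁ a
bigAndᵢ-elim (suc m) a (suc d) = bigAndᵢ-elim m (∧E₂ a) d

⟷refl : Γ ⊢ A ⟷ A
⟷refl = ⟷I h0 h0

⟷trans : Γ ⊢ A ⟷ B → Γ ⊢ B ⟷ C → Γ ⊢ A ⟷ C
⟷trans d e = ⟷I (⟷E₁ (wk e) (⟷E₁ (wk d) h0)) (⟷E₂ (wk d) (⟷E₂ (wk e) h0))

∨cong : Γ ⊢ A ⟷ B → Γ ⊢ C ⟷ D → Γ ⊢ (A ∨ C) ⟷ (B ∨ D)
∨cong d e = ⟷I (∨E h0 (∨I₁ (⟷E₁ (wk (wk d)) h0)) (∨I₂ (⟷E₁ (wk (wk e)) h0)))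
               (∨E h0 (∨I₁ (⟷E₂ (wk (wk d)) h0)) (∨I₂ (⟷E₂ (wk (wk e)) h0)))

∼cong : Γ ⊢ A ⟷ B → Γ ⊢ ∼ A ⟷ ∼ B
∼cong {A = A} {B = B} d = ⟷I (∼I {ψ = A} (⟷E₂ (wk (wk d)) h0) h1)
                              (∼I {ψ = B} (⟷E₁ (wk (wk d)) h0) h1)

∧cong : Γ ⊢ A ⟷ B → Γ ⊢ C ⟷ D → Γ ⊢ (A ∧ C) ⟷ (B ∧ D)
∧cong d e = ∼cong (∨cong (∼cong d) (∼cong e))

∃₂cong : map wkP Γ ⊢ A ⟷ B → Γ ⊢ ∃₂ A ⟷ ∃₂ B
∃₂cong {A = A} {B = B} d =
  ⟷I (∃₂E h0 (∃₂I zero (conv (sym (subP0-lift-wk B)) (⟷E₁ (wk (wk d)) h0))))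
     (∃₂E h0 (∃₂I zero (conv (sym (subP0-lift-wk A)) (⟷E₂ (wk (wk d)) h0))))

∀₁E₂ : Γ ⊢ ∀₁ (∀₁ A) → (t u : Term k i) → Γ ⊢ substF (σ₂ t u) A
∀₁E₂ {A = A} d t u = conv (trans (sub0-as-substF _ u) (substF-comp (σ0 u) (liftS (σ0 t)) A))
                          (∀₁E (conv (sub0-as-substF (∀₁ A) t) (∀₁E d t)) u)

≐refl : ∀ (t : Term k i) → Γ ⊢ t ≐ t
≐refl t = ∀₁E (axm eq-refl) t

leibnizBody : Form k (suc i) p → Form k (suc (suc i)) p
leibnizBody φ = (v1 ≐ v0) ⊃ (substF (var ∘ atX) φ ⊃ substF (var ∘ atY) φ)

leibniz-instance : ∀ (φ : Form k (suc i) p) (t u : Term k i) →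
  substF (σ₂ t u) (leibnizBody φ) ≡ ((t ≐ u) ⊃ (sub0 φ t ⊃ sub0 φ u))
leibniz-instance φ t u =
  cong₂ (λ a b → ∼ a ∨ b) (cong (_≐ u) (σ0-wkT t u))
    (cong₂ (λ a b → ∼ a ∨ b)
      (trans (substF-comp (σ₂ t u) (var ∘ atX) φ) (trans (substF-ext atX-σ₂ φ) (sym (sub0-as-substF φ t))))
      (trans (substF-comp (σ₂ t u) (var ∘ atY) φ) (trans (substF-ext atY-σ₂ φ) (sym (sub0-as-substF φ u)))))
  where
  atX-σ₂ : ∀ x → σ₂ t u (atX x) ≡ σ0 t x
  atX-σ₂ zero    = σ0-wkT t u
  atX-σ₂ (suc x) = refl
  atY-σ₂ : ∀ x → σ₂ t u (atY x) ≡ σ0 u x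
  atY-σ₂ zero    = refl
  atY-σ₂ (suc x) = refl

≐-subst : ∀ {t u : Term k i} → Γ ⊢ t ≐ u → (φ : Form k (suc i) p) → Γ ⊢ sub0 φ t → Γ ⊢ sub0 φ u
≐-subst {t = t} {u} e φ d = ⊃E (⊃E (conv (leibniz-instance φ t u) (∀₁E₂ (axm (leibniz φ)) t u)) e) d

≐-subst′ : ∀ {t u : Term k i} {A B} → Γ ⊢ t ≐ u → (φ : Form k (suc i) p) →
  substF (σ0 t) φ ≡ A → substF (σ0 u) φ ≡ B → Γ ⊢ A → Γ ⊢ B
≐-subst′ {t = t} {u} e φ ea eb d =
  conv (trans (sub0-as-substF φ u) eb) (≐-subst e φ (conv (sym (trans (sub0-as-substF φ t) ea)) d))

≐sym : ∀ {t u : Term k i} → Γ ⊢ t ≐ u → Γ ⊢ u ≐ t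
≐sym {t = t} {u} e = ≐-subst′ e (v0 ≐ wkT t) (cong (t ≐_) (σ0-wkT t t)) (cong (u ≐_) (σ0-wkT t u)) (≐refl t)

≐trans : ∀ {t u w : Term k i} → Γ ⊢ t ≐ u → Γ ⊢ u ≐ w → Γ ⊢ t ≐ w
≐trans {t = t} {u} {w} e f = ≐-subst′ f (wkT t ≐ v0) (cong (_≐ u) (σ0-wkT t u)) (cong (_≐ w) (σ0-wkT t w)) e

mem-≐ : ∀ {t u : Term k i} {X} → Γ ⊢ t ≐ u → Γ ⊢ mem X t → Γ ⊢ mem X u
mem-≐ {X = X} e d = ≐-subst e (mem X v0) d

≺-≐ʳ : ∀ {t u w : Term k i} → Γ ⊢ t ≐ u → Γ ⊢ w ≺ t → Γ ⊢ w ≺ u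
≺-≐ʳ {t = t} {u} {w} e d = ≐-subst′ e (wkT w ≺ v0) (cong (_≺ t) (σ0-wkT w t)) (cong (_≺ u) (σ0-wkT w u)) d

S-≐ : ∀ {t u : Term k i} d → Γ ⊢ t ≐ u → Γ ⊢ S d t ≐ S d u
S-≐ {t = t} {u} d e = ≐-subst′ e (S d (wkT t) ≐ S d v0) (cong (λ a → S d a ≐ S d t) (σ0-wkT t t))
   (cong (λ a → S d a ≐ S d u) (σ0-wkT t u)) (≐refl (S d t))

falsumE : ∀ {B} → Γ ⊢ falsum → Γ ⊢ B
falsumE d = ∼E (≐refl Root) d

∼I-falsum : ∀ {A} → A ∷ Γ ⊢ falsum → Γ ⊢ ∼ A
∼I-falsum d = ∼I {ψ = Root ≐ Root} (≐refl Root) d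

≺irr : ∀ {t : Term k i} {A} → Γ ⊢ t ≺ t → Γ ⊢ A
≺irr {t = t} d = ∼E (∃₁I t d) (axm lt-irr)

≺trans : ∀ {k i p} {Γ : List (Form k i p)} {t u w : Term k i} → Γ ⊢ t ≺ u → Γ ⊢ u ≺ w → Γ ⊢ t ≺ w
≺trans {k} {i} {p} {t = t} {u} {w} d e =
  ⊃E (⊃E (conv transitivity-instance (∀₁E (∀₁E₂ (axm lt-trans) t u) w)) d) e
  where
  transitivity : Form k (suc (suc (suc i))) p
  transitivity = (v2 ≺ v1) ⊃ ((v1 ≺ v0) ⊃ (v2 ≺ v0))
  transitivity-instance : sub0 (substF (liftS (σ₂ t u)) transitivity) w ≡ ((t ≺ u) ⊃ ((u ≺ w) ⊃ (t ≺ w)))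
  transitivity-instance = trans (sub0-as-substF (substF (liftS (σ₂ t u)) transitivity) w)
    (cong₂ (λ a b → ∼ (a ≺ b) ∨ (∼ (b ≺ w) ∨ (a ≺ w))) (trans (σ0-wkT _ w) (σ0-wkT t u)) (σ0-wkT u w))

root≤ : ∀ (t : Term k i) → Γ ⊢ Root ≼ t
root≤ t = ∀₁E (axm root-min) t

≺S⇔≼ : ∀ d (t u : Term k i) → Γ ⊢ (t ≺ S d u) ⟷ (t ≼ u)
≺S⇔≼ {k = k} d t u =
  conv (cong (λ a → (a ≺ S d u) ⟷ (a ≼ u)) (σ0-wkT t u))
       (bigAndE k (conv (substF-bigAnd (σ₂ t u) k succAxiom) (∀₁E₂ (axm lt-succ) t u)) d)
  where
  succAxiom : Fin (suc k) → Form k (suc (suc i)) p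
  succAxiom d = (v1 ≺ S d v0) ⟷ (v1 ≼ v0)

≼⇒≺S : ∀ {t u : Term k i} d → Γ ⊢ t ≼ u → Γ ⊢ t ≺ S d u
≼⇒≺S {t = t} {u} d e = ⟷E₂ (≺S⇔≼ d t u) e

≺S⇒≼ : ∀ {t u : Term k i} d → Γ ⊢ t ≺ S d u → Γ ⊢ t ≼ u
≺S⇒≼ {t = t} {u} d e = ⟷E₁ (≺S⇔≼ d t u) e

≺Root-elim : ∀ {t : Term k i} {B} → Γ ⊢ t ≺ Root → Γ ⊢ B
≺Root-elim {t = t} d = ∨E (root≤ t) (≺irr (≺trans (wk d) h0)) (≺irr (≺-≐ʳ h0 (wk d)))

succσ : Fin (suc k) → Fin (suc i) → Term k (suc i)
succσ d zero = S d v0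
succσ d (suc x) = var (suc x)

instantiate-v0 : ∀ {Δ : List (Form k (suc i) p)} {Z} (φ : Form k (suc i) p) →
  Δ ⊢ ∀₁ (mem Z v0 ⟷ substF (liftS (var ∘ suc)) φ) → Δ ⊢ mem Z v0 ⟷ φ
instantiate-v0 {Z = Z} φ d = conv (sub0-lift-wk (mem Z v0 ⟷ φ)) (∀₁E d v0)

-- The induction axiom applied to V = {y | P y}, obtained by comprehension.
induction-rule : ∀ {k i p} {Γ : List (Form k i p)} (P : Form k (suc i) p) → Γ ⊢ sub0 P Root →
  (∀ d → Γ ⊢ ∀₁ (P ⊃ substF (succσ d) P)) → Γ ⊢ ∀₁ P
induction-rule {k} {i} {p} {Γ} P base step = cut base (cut (wk (bigAndI k step)) (∃₂E (axm (compr P)) all-in-V⇒P))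
  where
  step-formula : Fin (suc k) → Form k i p
  step-formula d = ∀₁ (P ⊃ substF (succσ d) P)
  V-definition : Form k i (suc p)
  V-definition = ∀₁ (mem zero v0 ⟷ wkP P)
  Γ′ = V-definition ∷ wkP (⋀ step-formula) ∷ wkP (sub0 P Root) ∷ map wkP Γ
  V-closed-formula : ∀ {q} → Fin (suc k) → Form k i (suc q)
  V-closed-formula d = ∀₁ (mem zero v0 ⊃ mem zero (S d v0))
  induction-at-V : Γ′ ⊢ mem zero Root ⊃ (⋀ V-closed-formula ⊃ ∀₁ (mem zero v0))
  induction-at-V =
    conv (cong (λ a → mem zero Root ⊃ (a ⊃ ∀₁ (mem zero v0))) (renP-bigAnd (ρ0 zero) k V-closed-formula))
         (conv (subP0-as-renP (mem zero Root ⊃ (⋀ V-closed-formula ⊃ ∀₁ (mem zero v0))) zero)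
               (∀₂E (axm induction) zero))
  V-mem⇔P : (u : Term k i) → Γ′ ⊢ mem zero u ⟷ renP suc (substF (σ0 u) P)
  V-mem⇔P u = conv (cong (mem zero u ⟷_) (trans (sub0-as-substF (wkP P) u) (substF-renP (σ0 u) suc P))) (∀₁E h0 u)
  Root∈V : Γ′ ⊢ mem zero Root
  Root∈V = ⟷E₂ (V-mem⇔P Root) (conv (cong wkP (sub0-as-substF P Root)) h2)
  step-at : ∀ d → Γ′ ⊢ ∀₁ (wkP P ⊃ renP suc (substF (succσ d) P))
  step-at d = bigAndE k (conv (renP-bigAnd suc k step-formula) h1) d
  succσ-instance : ∀ d → sub0 (substF (liftS (var ∘ suc)) (wkP P)) (S d v0) ≡ renP suc (substF (succσ d) P)
  succσ-instance d = trans (sub0-as-substF _ (S d v0)) (trans (substF-comp _ _ (wkP P))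
           (trans (substF-ext (λ { zero → refl ; (suc x) → refl }) (wkP P)) (substF-renP (succσ d) suc P)))
  V-closed : Γ′ ⊢ ⋀ V-closed-formula
  V-closed = bigAndI k (λ d → cut (step-at d) (∀₁I (⊃I
            (⟷E₂ (conv (cong (λ a → mem zero (S d v0) ⟷ a) (succσ-instance d)) (∀₁E h2 (S d v0)))
                 (⊃E (conv (sub0-lift-wk (wkP P ⊃ renP suc (substF (succσ d) P))) (∀₁E h1 v0))
                     (⟷E₁ (instantiate-v0 (wkP P) h2) h0))))))
  all-in-V⇒P : Γ′ ⊢ wkP (∀₁ P)
  all-in-V⇒P = cut (⊃E (⊃E induction-at-V Root∈V) V-closed)
                   (∀₁I (⟷E₁ (instantiate-v0 (wkP P) h1) (∀₁E h0 v0)))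

Singleton : Fin p → Term k i → Form k i p
Singleton X t = ∀₁ (mem X v0 ⟷ (v0 ≐ wkT t))

wkI-Singleton : ∀ (X : Fin p) (t : Term k i) → wkI (Singleton X t) ≡ Singleton X (wkT t)
wkI-Singleton X t = cong (λ a → ∀₁ (mem X v0 ⟷ (v0 ≐ a))) (liftS-wkT (var ∘ suc) t)

Singleton-mem⇔≐ : ∀ {X t} → Γ ⊢ Singleton X t → (u : Term k i) → Γ ⊢ mem X u ⟷ (u ≐ t)
Singleton-mem⇔≐ {X = X} {t = t} d u =
  conv (trans (sub0-as-substF (mem X v0 ⟷ (v0 ≐ wkT t)) u) (cong (λ a → mem X u ⟷ (u ≐ a)) (σ0-wkT t u))) (∀₁E d u)

Singleton-mem : ∀ {X t} → Γ ⊢ Singleton X t → Γ ⊢ mem X t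
Singleton-mem {t = t} d = ⟷E₂ (Singleton-mem⇔≐ d t) (≐refl t)

Singleton-≐ : ∀ {X t u} → Γ ⊢ Singleton X t → Γ ⊢ mem X u → Γ ⊢ u ≐ t
Singleton-≐ {u = u} d m = ⟷E₁ (Singleton-mem⇔≐ d u) m

Singleton-exists : ∀ (t : Term k i) → Γ ⊢ ∃₂ (Singleton zero t)
Singleton-exists t = axm (compr (v0 ≐ wkT t))

Singleton-≐-cong : ∀ {X} {t u : Term k i} → Γ ⊢ Singleton X t → Γ ⊢ t ≐ u → Γ ⊢ Singleton X u
Singleton-≐-cong {X = X} {t} {u} s e = cut s (cut (wk e) (∀₁I (⟷I
   (≐trans (Singleton-≐ (conv (wkI-Singleton X t) h2) h0) h1)
   (⟷E₂ (Singleton-mem⇔≐ (conv (wkI-Singleton X t) h2) v0) (≐trans h0 (≐sym h1))))))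

empty-exists : Γ ⊢ ∃₂ (∀₁ (mem zero v0 ⟷ falsum))
empty-exists = axm (compr falsum)

emptyᵢ : Fin q → IFForm k q
emptyᵢ X = ∀ᵢ (suc X ⊆̇ zero)

singletonᵢ : Fin q → IFForm k q
singletonᵢ X = ¬ᵢ (emptyᵢ X) ∧ᵢ ∀ᵢ ((zero ⊆̇ suc X) ⊃ᵢ (emptyᵢ zero ∨ᵢ (suc X ⊆̇ zero)))

emptyᵢ-elim : ∀ {X t B} → Γ ⊢ ⟪ emptyᵢ X ⟫ → Γ ⊢ mem X t → Γ ⊢ B
emptyᵢ-elim {X = X} {t} e m = cut e (cut (wk m) (∃₂E empty-exists
   (falsumE (⟷E₁ (∀₁E h0 t) (⊃E (∀₁E (∀₂E h2 zero) t) h1)))))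

singletonᵢ-elim : ∀ {k i p} {Γ : List (Form k i p)} {X} → Γ ⊢ ⟪ singletonᵢ X ⟫ → Γ ⊢ ∃₁ (Singleton X v0)
singletonᵢ-elim {k} {i} {p} {Γ} {X} s = cut (∧E₂ s) (∃₁E (wk ex) (∃₁I v0 (∀₁I (⟷I partA partB))))
  where
  ex : Γ ⊢ ∃₁ (mem X v0)
  ex = raa (∀₂I (∀₁I (⊃I (∼E (∃₁I v0 h0) h1)))) (wk (∧E₁ s))
  partB : ∀ {Δ : List (Form k (suc (suc i)) p)} → v0 ≐ v1 ∷ mem X v1 ∷ Δ ⊢ mem X v0
  partB = mem-≐ (≐sym h0) h1
  partA = ∃₂E (Singleton-exists v1)
            (∨E (⊃E (∀₂E h3 zero) (∀₁I (⊃I (mem-≐ (≐sym (Singleton-≐ h1 h0)) h3))))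
                (emptyᵢ-elim h0 (Singleton-mem h1))
                (Singleton-≐ h1 (⊃E (∀₁E h0 v0) h2)))

singletonᵢ-intro : ∀ {k i p} {Γ : List (Form k i p)} {X t} → Γ ⊢ Singleton X t → Γ ⊢ ⟪ singletonᵢ X ⟫
singletonᵢ-intro {k} {i} {p} {Γ} {X} {t} d =
  ∧I (∼I {ψ = falsum} (emptyᵢ-elim h0 (Singleton-mem {t = t} (wk d)))
                      (emptyᵢ-elim h0 (Singleton-mem {t = t} (wk d))))
     (cut d (∀₂I (⊃I (∨E (excluded-middle {A = mem zero t})
        (∨I₂ (∀₁I (⊃I (mem-≐ (≐sym {t = v0} {u = wkT t} (Singleton-≐ (conv (wkI-Singleton (suc X) t) h3) h0)) h1))))
        (∨I₁ (∀₂I (∀₁I (⊃I (∼E (mem-≐ (Singleton-≐ (conv (wkI-Singleton (suc (suc X)) t) h3) (⊃E (∀₁E h2 v0) h0)) h0)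
                               h1)))))))))

FSucc-intro : ∀ {d A B} {t u : Term k i} → Γ ⊢ mem A t → Γ ⊢ mem B u → Γ ⊢ S d t ≐ u → Γ ⊢ ⟪ FSucc d A B ⟫
FSucc-intro {d = d} {A} {B} {t} {u} a b e = ∃₁I t (∃₁I u (conv eq (∧I a (∧I b e))))
  where
  Ft = mem A (wkT t) ∧ (mem B v0 ∧ (S d (wkT t) ≐ v0))
  eq : (mem A t ∧ (mem B u ∧ (S d t ≐ u))) ≡ sub0 Ft u
  eq = sym (trans (sub0-as-substF Ft u) (cong (λ a → mem A a ∧ (mem B u ∧ (S d a ≐ u))) (σ0-wkT t u)))

closedUnderᵢ : Fin (suc k) → Fin q → Fin q → IFForm k q
closedUnderᵢ d A B = ∀ᵢ ((singletonᵢ zero ∧ᵢ FSucc d (suc A) zero) ⊃ᵢ (zero ⊆̇ suc B))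

closedᵢ : ∀ {k q} → Fin q → Fin q → IFForm k q
closedᵢ {k} A B = bigAndᵢ k (λ d → closedUnderᵢ d A B)

renIF-closedᵢ : ∀ {k p q} (ρ : Fin p → Fin q) (A B : Fin p) → renIF ρ (closedᵢ {k} A B) ≡ closedᵢ (ρ A) (ρ B)
renIF-closedᵢ {k} ρ A B = trans (renIF-bigAndᵢ ρ k _) (bigAndᵢ-ext k (λ d → refl))

closedᵢ-elim : ∀ {k i p} {Γ : List (Form k i p)} {A B} {t : Term k i} →
  Γ ⊢ ⟪ closedᵢ A B ⟫ → ∀ d → Γ ⊢ mem A t → Γ ⊢ mem B (S d t)
closedᵢ-elim {k} {t = t} cl d m = cut (bigAndᵢ-elim k cl d) (cut (wk m) (∃₂E (Singleton-exists (S d t))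
   (⊃E (∀₁E (⊃E (∀₂E h2 zero) (∧I (singletonᵢ-intro {t = S d t} h0)
                                  (FSucc-intro h1 (Singleton-mem {t = S d t} h0) (≐refl _))))
            (S d t))
       (Singleton-mem {t = S d t} h0))))

closedᵢ-intro : ∀ {k i p} {Γ : List (Form k i p)} {A B} →
  (∀ d → Γ ⊢ ∀₁ (mem A v0 ⊃ mem B (S d v0))) → Γ ⊢ ⟪ closedᵢ A B ⟫
closedᵢ-intro {k} prem = bigAndᵢ-intro k (λ d → cut (prem d) (∀₂I (⊃I
   (∃₁E (singletonᵢ-elim (∧E₁ h0)) (∃₁E (∧E₂ h1) (∃₁E h0
      (cut (mem-≐ (≐trans (∧E₂ (∧E₂ h0)) (Singleton-≐ h2 (∧E₁ (∧E₂ h0)))) (⊃E (∀₁E h4 v1) (∧E₁ h0)))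
        (∀₁I (⊃I (mem-≐ (≐sym (Singleton-≐ h4 h0)) h1))))))))))

-- X < Y: Y ⊆ W for every W with S[X] ⊆ W and S[W] ⊆ W.
lessᵢ : Fin q → Fin q → IFForm k q
lessᵢ X Y = ∀ᵢ ((closedᵢ (suc X) zero ∧ᵢ closedᵢ zero zero) ⊃ᵢ (suc Y ⊆̇ zero))

renIF-lessᵢ : ∀ (ρ : Fin p → Fin q) (X Y : Fin p) → renIF ρ (lessᵢ {k = k} X Y) ≡ lessᵢ (ρ X) (ρ Y)
renIF-lessᵢ ρ X Y = cong₂ (λ a b → ∀ᵢ ((a ∧ᵢ b) ⊃ᵢ (suc (ρ Y) ⊆̇ zero)))
                           (renIF-closedᵢ (liftR ρ) (suc X) zero) (renIF-closedᵢ (liftR ρ) zero zero)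

renP-lessᵢ : ∀ (ρ : Fin p → Fin q) (X Y : Fin p) → renP ρ (⟪_⟫ {i = i} (lessᵢ {k = k} X Y)) ≡ ⟪ lessᵢ (ρ X) (ρ Y) ⟫
renP-lessᵢ ρ X Y = trans (renP-⟪⟫ ρ (lessᵢ X Y)) (cong ⟪_⟫ (renIF-lessᵢ ρ X Y))

lessᵢ-instance : ∀ {X Y} → Γ ⊢ ⟪ lessᵢ X Y ⟫ → (W : Fin p) → Γ ⊢ ⟪ (closedᵢ X W ∧ᵢ closedᵢ W W) ⊃ᵢ (Y ⊆̇ W) ⟫
lessᵢ-instance {X = X} {Y} d W = conv instance-at-W (∀₂E d W)
  where
  body = (closedᵢ (suc X) zero ∧ᵢ closedᵢ zero zero) ⊃ᵢ (suc Y ⊆̇ zero)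
  instance-at-W = trans (subP0-as-renP ⟪ body ⟫ W) (trans (renP-⟪⟫ (ρ0 W) body)
    (cong ⟪_⟫ (cong₂ (λ a b → (a ∧ᵢ b) ⊃ᵢ (Y ⊆̇ W))
                     (renIF-closedᵢ (ρ0 W) (suc X) zero) (renIF-closedᵢ (ρ0 W) zero zero))))

Above : Fin p → Term k i → Form k i p
Above Z t = ∀₁ (mem Z v0 ⟷ (wkT t ≺ v0))

wkI-Above : ∀ (Z : Fin p) (t : Term k i) → wkI (Above Z t) ≡ Above Z (wkT t)
wkI-Above Z t = cong (λ a → ∀₁ (mem Z v0 ⟷ (a ≺ v0))) (liftS-wkT (var ∘ suc) t)

Above-mem⇔≺ : ∀ {Z} {t : Term k i} → Γ ⊢ Above Z t → (v : Term k i) → Γ ⊢ mem Z v ⟷ (t ≺ v)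
Above-mem⇔≺ {Z = Z} {t} d v =
  conv (trans (sub0-as-substF (mem Z v0 ⟷ (wkT t ≺ v0)) v) (cong (λ a → mem Z v ⟷ (a ≺ v)) (σ0-wkT t v))) (∀₁E d v)

lessᵢ-elim : ∀ {X Y} {t u : Term k i} → Γ ⊢ Singleton X t → Γ ⊢ Singleton Y u → Γ ⊢ ⟪ lessᵢ X Y ⟫ → Γ ⊢ t ≺ u
lessᵢ-elim {X = X} {Y} {t} {u} sx sy ls = cut sx (cut (wk sy) (cut (wk (wk ls)) (∃₂E (axm (compr (wkT t ≺ v0)))
   (⟷E₁ (Above-mem⇔≺ {t = t} h0 u)
         (⊃E (∀₁E (⊃E (lessᵢ-instance (conv (renP-lessᵢ suc X Y) h1) zero) (∧I X-succ⊆Above Above-succ-closed)) u)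
             (Singleton-mem {t = u} h2))))))
  where
  X-succ⊆Above = closedᵢ-intro (λ d → ∀₁I (⊃I (⟷E₂ (Above-mem⇔≺ {t = wkT t} (conv (wkI-Above zero t) h1) (S d v0))
           (≼⇒≺S d (∨I₂ (≐sym (Singleton-≐ (conv (wkI-Singleton (suc X) t) h4) h0)))))))
  Above-succ-closed = closedᵢ-intro (λ d → ∀₁I (⊃I (⟷E₂ (Above-mem⇔≺ {t = wkT t} (conv (wkI-Above zero t) h1) (S d v0))
           (≼⇒≺S d (∨I₁ (⟷E₁ (Above-mem⇔≺ {t = wkT t} (conv (wkI-Above zero t) h1) v0) h0))))))

lessᵢ-intro : ∀ {k i p} {Γ : List (Form k i p)} {X Y} {t u : Term k i} →
  Γ ⊢ Singleton X t → Γ ⊢ Singleton Y u → Γ ⊢ t ≺ u → Γ ⊢ ⟪ lessᵢ X Y ⟫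
lessᵢ-intro {k} {i} {p} {Γ} {X} {Y} {t} {u} sx sy lt = cut sx (cut (wk sy) (cut (wk (wk lt)) (∀₂I (⊃I
   (cut (∧E₁ h0) (cut (∧E₂ h1) (cut u∈W
      (∀₁I (⊃I (mem-≐ (≐sym (Singleton-≐ (conv (wkI-Singleton (suc Y) u) h6) h0)) h1))))))))))
  where
  t≺v⇒W : Form k (suc i) (suc p)
  t≺v⇒W = (wkT t ≺ v0) ⊃ mem zero v0
  Γ′ = ⟪ closedᵢ zero zero ⟫ ∷ ⟪ closedᵢ (suc X) zero ⟫ ∷ ⟪ closedᵢ (suc X) zero ∧ᵢ closedᵢ zero zero ⟫
       ∷ (t ≺ u) ∷ Singleton (suc Y) u ∷ Singleton (suc X) t ∷ map wkP Γ
  t≺v⇒W-at : ∀ v → sub0 t≺v⇒W v ≡ ((t ≺ v) ⊃ mem zero v)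
  t≺v⇒W-at v = trans (sub0-as-substF t≺v⇒W v) (cong (λ a → (a ≺ v) ⊃ mem zero v) (σ0-wkT t v))
  succσ-wkT : ∀ d → substT (succσ d) (wkT t) ≡ wkT t
  succσ-wkT d = substT-comp (succσ d) (var ∘ suc) t
  all-t≺v⇒W : Γ′ ⊢ ∀₁ t≺v⇒W
  all-t≺v⇒W = induction-rule t≺v⇒W (conv (sym (t≺v⇒W-at Root)) (⊃I (≺Root-elim h0)))
     (λ d → ∀₁I (conv (cong (λ a → t≺v⇒W ⊃ ((a ≺ S d v0) ⊃ mem zero (S d v0))) (sym (succσ-wkT d)))
        (⊃I (⊃I (∨E (≺S⇒≼ d h0)
            (closedᵢ-elim (conv (wkI-⟪⟫ (closedᵢ zero zero)) h3) d (⊃E h2 h0))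
            (closedᵢ-elim (conv (wkI-⟪⟫ (closedᵢ (suc X) zero)) h4) d
               (mem-≐ h0 (Singleton-mem {t = wkT t} (conv (wkI-Singleton (suc X) t) h8)))))))))
  u∈W : Γ′ ⊢ mem zero u
  u∈W = ⊃E (conv (t≺v⇒W-at u) (∀₁E all-t≺v⇒W u)) h3

isRootᵢ : Fin q → IFForm k q
isRootᵢ Z = singletonᵢ Z ∧ᵢ ∀ᵢ (singletonᵢ zero ⊃ᵢ ¬ᵢ (lessᵢ zero (suc Z)))

isRootᵢ-intro : ∀ {Z} → Γ ⊢ Singleton Z Root → Γ ⊢ ⟪ isRootᵢ Z ⟫
isRootᵢ-intro {Z = Z} s = ∧I (singletonᵢ-intro {t = Root} s) (cut s (∀₂I (⊃I (∼I-falsum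
   (∃₁E (singletonᵢ-elim h1)
        (≺Root-elim (lessᵢ-elim {t = v0} {u = Root} h0 h3 (conv (wkI-⟪⟫ (lessᵢ zero (suc Z))) h1))))))))

isRootᵢ-elim : ∀ {Z} → Γ ⊢ ⟪ isRootᵢ Z ⟫ → Γ ⊢ Singleton Z Root
isRootᵢ-elim {Z = Z} r = cut (∧E₂ r) (∃₁E (singletonᵢ-elim (wk (∧E₁ r)))
   (Singleton-≐-cong {t = v0} h0 (∨E (root≤ v0)
      (∃₂E (Singleton-exists Root) (∼E (lessᵢ-intro {t = Root} {u = v0} h0 h2 h1)
          (⊃E (conv (subP0-lift-wk ⟪ minimal ⟫) (∀₂E (conv (cong wkP (wkI-⟪⟫ (∀ᵢ minimal))) h3) zero))
              (singletonᵢ-intro {t = Root} h0))))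
      (≐sym h0))))
  where
  minimal = singletonᵢ zero ⊃ᵢ ¬ᵢ (lessᵢ zero (suc Z))

isSuccᵢ : Fin (suc k) → Fin q → Fin q → IFForm k q
isSuccᵢ d W Z = singletonᵢ Z ∧ᵢ FSucc d W Z

isSuccᵢ-intro : ∀ {d W Z} {t : Term k i} → Γ ⊢ Singleton W t → Γ ⊢ Singleton Z (S d t) → Γ ⊢ ⟪ isSuccᵢ d W Z ⟫
isSuccᵢ-intro {d = d} {t = t} sw sz =
  ∧I (singletonᵢ-intro {t = S d t} sz) (FSucc-intro (Singleton-mem {t = t} sw) (Singleton-mem {t = S d t} sz) (≐refl _))

isSuccᵢ-elim : ∀ {d W Z} {t : Term k i} → Γ ⊢ Singleton W t → Γ ⊢ ⟪ isSuccᵢ d W Z ⟫ → Γ ⊢ Singleton Z (S d t)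
isSuccᵢ-elim {d = d} {W} {Z} {t} sw sp = cut sw (cut (wk sp) (∃₁E (singletonᵢ-elim (∧E₁ h0))
   (conv (sym (wkI-Singleton Z (S d t))) (Singleton-≐-cong {t = v0} {u = S d (wkT t)} h0
      (∃₁E (∧E₂ h1) (∃₁E h0
         (≐trans (≐sym (Singleton-≐ h2 (∧E₁ (∧E₂ h0))))
           (≐trans (≐sym (∧E₂ (∧E₂ h0)))
              (S-≐ d (Singleton-≐ {t = wkT (wkT (wkT t))} (conv wkI³-Singleton h4) (∧E₁ h0)))))))))))
  where
  wkI³-Singleton = trans (cong wkI (cong wkI (wkI-Singleton W t)))
                         (trans (cong wkI (wkI-Singleton W (wkT t))) (wkI-Singleton W (wkT (wkT t))))

denotesᵢ : (Fin i → Fin q) → Term k i → Fin q → IFForm k q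
denotesᵢ ι (var j) Z = (Z ⊆̇ ι j) ∧ᵢ (ι j ⊆̇ Z)
denotesᵢ ι Root Z = isRootᵢ Z
denotesᵢ ι (S d t) Z = ∃ᵢ (denotesᵢ (suc ∘ ι) t zero ∧ᵢ isSuccᵢ d zero (suc Z))

Represents : List (Form k i q) → (Fin i → Fin q) → Set
Represents Γ ι = ∀ j → Singleton (ι j) (var j) ∈ Γ

Represents-wkP : ∀ {ι : Fin i → Fin q} → Represents Γ ι → Represents (map wkP Γ) (suc ∘ ι)
Represents-wkP H j = ∈-map⁺ wkP (H j)

denotesᵢ-correct : ∀ {Γ : List (Form k i q)} (ι : Fin i → Fin q) → Represents Γ ι → (t : Term k i) (Z : Fin q) →
  Γ ⊢ Singleton Z t ⟷ ⟪ denotesᵢ ι t Z ⟫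
denotesᵢ-correct {Γ = Γ} ι H (var j) Z = ⟷I
  (∧I (∀₁I (⊃I (mem-≐ (≐sym (Singleton-≐ h1 h0)) (Singleton-mem {t = var (suc j)} ι-j))))
      (∀₁I (⊃I (mem-≐ (≐sym (Singleton-≐ ι-j h0)) (Singleton-mem {t = var (suc j)} h1)))))
  (∀₁I (⟷I (Singleton-≐ ι-j (⊃E (∀₁E (∧E₁ h1) v0) h0))
           (⊃E (∀₁E (∧E₂ h1) v0) (⟷E₂ (Singleton-mem⇔≐ ι-j v0) h0))))
  where
  ι-j : ∀ {A B} → A ∷ B ∷ map wkI Γ ⊢ Singleton (ι j) (var (suc j))
  ι-j = hyp (there (there (∈-map⁺ wkI (H j))))
denotesᵢ-correct ι H Root Z = ⟷I (isRootᵢ-intro h0) (isRootᵢ-elim h0)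
denotesᵢ-correct {Γ = Γ} ι H (S d t) Z = ⟷I
  (∃₂E (Singleton-exists t) (∃₂I zero (conv (sym (subP0-lift-wk ⟪ body ⟫))
     (∧I (⟷E₁ denotes-t h0) (isSuccᵢ-intro {t = t} h0 h1)))))
  (∃₂E h0 (isSuccᵢ-elim {t = t} (⟷E₂ denotes-t (∧E₁ h0)) (∧E₂ h0)))
  where
  body = denotesᵢ (suc ∘ ι) t zero ∧ᵢ isSuccᵢ d zero (suc Z)
  denotes-t : ∀ {A B} → A ∷ B ∷ map wkP Γ ⊢ Singleton zero t ⟷ ⟪ denotesᵢ (suc ∘ ι) t zero ⟫
  denotes-t = denotesᵢ-correct (suc ∘ ι) (there ∘ there ∘ Represents-wkP H) t zero

mem-via-singleton : ∀ (X : Fin p) (t : Term k i) → Γ ⊢ mem X t ⟷ ∃₂ (Singleton zero t ∧ ⟪ zero ⊆̇ suc X ⟫)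
mem-via-singleton X t = ⟷I
  (∃₂E (Singleton-exists t) (∃₂I zero (conv (sym (subP0-lift-wk (Singleton zero t ∧ ⟪ zero ⊆̇ suc X ⟫)))
     (∧I h0 (∀₁I (⊃I (mem-≐ (≐sym (Singleton-≐ (conv (wkI-Singleton zero t) h1) h0)) h2)))))))
  (∃₂E h0 (⊃E (∀₁E (∧E₂ h0) t) (Singleton-mem {t = t} (∧E₁ h0))))

≐-via-singletons : ∀ (t u : Term k i) → Γ ⊢ (t ≐ u) ⟷ ∃₂ (Singleton zero t ∧ Singleton zero u)
≐-via-singletons t u = ⟷I
  (∃₂E (Singleton-exists t) (∃₂I zero (conv (sym (subP0-lift-wk (Singleton zero t ∧ Singleton zero u)))
                                             (∧I h0 (Singleton-≐-cong {t = t} h0 h1)))))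
  (∃₂E h0 (≐sym (Singleton-≐ {t = t} (∧E₁ h0) (Singleton-mem {t = u} (∧E₂ h0)))))

≺-via-singletons : ∀ {k i p} {Γ : List (Form k i p)} (t u : Term k i) →
  Γ ⊢ (t ≺ u) ⟷ ∃₂ (∃₂ (Singleton (suc zero) t ∧ (Singleton zero u ∧ ⟪ lessᵢ (suc zero) zero ⟫)))
≺-via-singletons {k} {i} {p} t u = ⟷I
  (∃₂E (Singleton-exists t) (∃₂E (Singleton-exists u)
     (∃₂I (suc zero) (conv (sym (subP0-as-renP (∃₂ Body↑) (suc zero)))
       (∃₂I zero (conv (sym (subP0-as-renP (renP (liftR (ρ0 (suc zero))) Body↑) zero))
         (conv (sym Body↑-instance) (∧I h1 (∧I h0 (lessᵢ-intro {t = t} {u = u} h1 h0 h2))))))))))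
  (∃₂E h0 (∃₂E h0 (lessᵢ-elim {t = t} {u = u} (∧E₁ h0) (∧E₁ (∧E₂ h0)) (∧E₂ (∧E₂ h0)))))
  where
  Body : Form k i (suc (suc p))
  Body = Singleton (suc zero) t ∧ (Singleton zero u ∧ ⟪ lessᵢ (suc zero) zero ⟫)
  Body↑ = renP (liftR (liftR suc)) (renP (liftR (liftR suc)) Body)
  cancel : ∀ x → ρ0 zero (liftR (ρ0 (suc zero)) (liftR (liftR suc) (liftR (liftR suc) x))) ≡ x
  cancel zero          = refl
  cancel (suc zero)    = refl
  cancel (suc (suc x)) = refl
  Body↑-instance : renP (ρ0 zero) (renP (liftR (ρ0 (suc zero))) Body↑) ≡ Body
  Body↑-instance = trans (renP-comp (ρ0 zero) (liftR (ρ0 (suc zero))) Body↑)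
        (trans (renP-comp _ (liftR (liftR suc)) (renP (liftR (liftR suc)) Body))
        (trans (renP-comp _ (liftR (liftR suc)) Body) (trans (renP-ext cancel Body) (renP-id Body))))

-- ι and π say which set variable stands for each individual variable (coded by its singleton)
-- and for each predicate variable.
translate : (Fin i → Fin q) → (Fin p → Fin q) → Form k i p → IFForm k q
translate ι π (mem X t) = ∃ᵢ (denotesᵢ (suc ∘ ι) t zero ∧ᵢ (zero ⊆̇ suc (π X)))
translate ι π (t ≐ u)   = ∃ᵢ (denotesᵢ (suc ∘ ι) t zero ∧ᵢ denotesᵢ (suc ∘ ι) u zero)
translate ι π (t ≺ u)   =
  ∃ᵢ (∃ᵢ (denotesᵢ (λ j → suc (suc (ι j))) t (suc zero)
      ∧ᵢ (denotesᵢ (λ j → suc (suc (ι j))) u zero ∧ᵢ lessᵢ (suc zero) zero)))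
translate ι π (φ ∨ ψ)   = translate ι π φ ∨ᵢ translate ι π ψ
translate ι π (∼ φ)     = ¬ᵢ (translate ι π φ)
translate ι π (∃₁ φ)    = ∃ᵢ (singletonᵢ zero ∧ᵢ translate (liftR ι) (suc ∘ π) φ)
translate ι π (∃₂ φ)    = ∃ᵢ (translate (suc ∘ ι) (liftR π) φ)

translate-correct : ∀ {k i p q} {Γ : List (Form k i q)} (ι : Fin i → Fin q) (π : Fin p → Fin q) →
  Represents Γ ι → (φ : Form k i p) → Γ ⊢ renP π φ ⟷ ⟪ translate ι π φ ⟫
translate-correct ι π H (mem X t) =
  ⟷trans (mem-via-singleton (π X) t) (∃₂cong (∧cong (denotesᵢ-correct (suc ∘ ι) (Represents-wkP H) t zero) ⟷refl))
translate-correct ι π H (t ≐ u) =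
  ⟷trans (≐-via-singletons t u) (∃₂cong (∧cong (denotesᵢ-correct (suc ∘ ι) (Represents-wkP H) t zero)
                                               (denotesᵢ-correct (suc ∘ ι) (Represents-wkP H) u zero)))
translate-correct ι π H (t ≺ u) =
  ⟷trans (≺-via-singletons t u) (∃₂cong (∃₂cong (∧cong (denotesᵢ-correct (λ j → suc (suc (ι j))) H₂ t (suc zero))
                                                       (∧cong (denotesᵢ-correct (λ j → suc (suc (ι j))) H₂ u zero) ⟷refl))))
  where
  H₂ = Represents-wkP (Represents-wkP H)
translate-correct ι π H (φ ∨ ψ) = ∨cong (translate-correct ι π H φ) (translate-correct ι π H ψ)
translate-correct ι π H (∼ φ)   = ∼cong (translate-correct ι π H φ)
translate-correct ι π H (∃₂ φ)  = ∃₂cong (translate-correct (suc ∘ ι) (liftR π) (Represents-wkP H) φ)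
translate-correct {Γ = Γ} ι π H (∃₁ φ) = ⟷I
  (∃₁E h0 (conv (sym (wkI-⟪⟫ (∃ᵢ (singletonᵢ zero ∧ᵢ T)))) (∃₂E (Singleton-exists v0) (∃₂I zero
     (conv (sym (subP0-lift-wk ⟪ singletonᵢ zero ∧ᵢ T ⟫))
       (∧I (singletonᵢ-intro {t = v0} h0)
           (⟷E₁ (translate-correct (liftR ι) (suc ∘ π) H′ φ) (conv (renP-comp suc π φ) h1))))))))
  (∃₂E h0 (∃₁E (singletonᵢ-elim (∧E₁ h0)) (∃₁I v0 (conv (sym (sub0-lift-wk (renP suc (renP π φ))))
     (conv (sym (renP-comp suc π φ))
           (⟷E₂ (translate-correct (liftR ι) (suc ∘ π) H″ φ) (conv (wkI-⟪⟫ T) (∧E₂ h1))))))))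
  where
  T = translate (liftR ι) (suc ∘ π) φ
  H′ : ∀ {A B} → Represents (Singleton zero v0 ∷ A ∷ B ∷ map wkP (map wkI Γ)) (liftR ι)
  H′ zero    = here refl
  H′ (suc j) = there (there (there (∈-map⁺ wkP (∈-map⁺ wkI (H j)))))
  H″ : ∀ {A B} → Represents (Singleton zero v0 ∷ A ∷ B ∷ map wkI (map wkP Γ)) (liftR ι)
  H″ zero    = here refl
  H″ (suc j) = there (there (there (∈-map⁺ wkI (∈-map⁺ wkP (H j)))))

corollary8p8 : (k : ℕ) (φ : Form k 0 0) →
    Σ (IFForm k 0) (λ ψ → MSO⊢ k (φ ⟷ ⟦ ψ ⟧))
corollary8p8 k φ = ψ , conv (cong₂ _⟷_ unrenamed (⟪⟫≡⟦⟧ ψ)) (translate-correct (λ ()) (λ ()) (λ ()) φ)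
  where
  ψ = translate (λ ()) (λ ()) φ
  unrenamed : renP (λ ()) φ ≡ φ
  unrenamed = trans (renP-ext (λ ()) φ) (renP-id φ)
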